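{- Let $\ell \in \mathbb{Z}_{\geq 0}$ and $M = 2^eM_1$ with $e \in \mathbb{Z}_{\geq 1}$ and $M_1 \in \mathbb{Z}_{\geq 1}$ odd. Let $f = 0$ if $e = 1$ and $f = e$ if $e \geq 2$, and let $\chi_{M,0}$ denote the principal character modulo $M$. (1) If $m \in \mathbb{Z}$ is odd, then $\Lambda_{\ell,m,M}\vert U_4\otimes\chi_{M,0} = 0$. (2) If $m = 2m_1$ with $m_1 \in \mathbb{Z}$, then \[ \Lambda_{\ell,m,M}\vert U_4\otimes\chi_{M,0} = 2^\ell\sum_{\substack{b_1 \pmod{2^{e-1}M_1}\\ \gcd(m_1^2-b_1^2,2^{e-1}M_1)=1}}G_{\ell,m_1-b_1,2^{e-1}M_1}\vert S_{2^fM_1,m_1^2-b_1^2}\vert S_{2,1}+2^{\ell-1}T_{\ell,m_1,2^{e-1}M_1}\otimes \chi_{M,0}. \] Here $\Lambda\vert U_4\otimes\chi$ means $(\Lambda\vert U_4)\otimes\chi$.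
   Context: Write $q = e^{2\pi i\tau}$. For $F = \sum_n a(n)q^n$: $F\vert U_M := \sum_n a(Mn)q^n$; for a Dirichlet character $\psi$, $F\otimes\psi := \sum_n \psi(n)a(n)q^n$; the sieving operator is $F\vert S_{M,m} := \sum_{n \in \mathbb{Z}} a(Mn+m)q^{Mn+m}$. For $\ell\in\mathbb{Z}_{\geq0}$, $m\in\mathbb{Z}$, $M\in\mathbb{Z}_{\geq1}$: $\Lambda_{\ell,m,M}(\tau) := \sum_{n\geq1}\lambda_{\ell,m,M}(n)q^n$ with $\lambda_{\ell,m,M}(n) := \sum_{\pm}\sum^{*}(t-s)^\ell$, where the inner sum is over integers $t>s\geq 0$ with $t^2-s^2=n$ and $t\equiv \pm m \pmod M$, the outer sum is over the two signs, and the $*$ means that terms with $s=0$ are counted with weight $\frac12$. Further $G_{\ell,m,M}(\tau) := \sum_{n\geq 1} g_{\ell,m,M}(n)q^n$ with $g_{\ell,m,M}(n) := \sum_{\pm}\sum_{d \mid n,\ 0<d<\sqrt{n},\ d\equiv \pm m \pmod{M}} d^\ell$, and $T_{\ell,m,M}(\tau) := \sum_{\pm}\sum_{n\geq 1,\ n \equiv \pm m \pmod{M}} n^\ell q^{n^2}$. -}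

module Defs where

open import Data.Bool using (Bool; true; false; if_then_else_)
open import Data.Nat as ℕ using (ℕ; zero; suc)
open import Data.Nat.GCD as NG using ()
open import Data.Integer as ℤ using (ℤ; +_)
import Data.Integer.Divisibility.Signed as ZDiv
import Data.Integer.GCD as ZG
open import Data.Rational as ℚ using (ℚ; 0ℚ; 1ℚ; ½)
open import Relation.Binary.PropositionalEquality using (_≡_)
open import Relation.Nullary using (Dec; does; _×-dec_)
import Data.Nat.Properties as NP
import Data.Integer.Properties as ZP
import Data.Nat.Divisibility as NDiv

-- q-series with coefficients a(n) for n ≥ 0.  All series in the statement
-- (Λ, G, T and everything derived from them) have a(n) = 0 for n ≤ 0,
-- so a series is determined by its coefficients indexed by ℕ.
Series : Set
Series = ℕ → ℚ

[_]⇒_ : {P : Set} → Dec P → ℚ → ℚ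
[ d ]⇒ x = if does d then x else 0ℚ

Σ< : ℕ → (ℕ → ℚ) → ℚ
Σ< zero    f = 0ℚ
Σ< (suc n) f = Σ< n f ℚ.+ f n

_≡_[mod_] : ℤ → ℤ → ℕ → Set
a ≡ b [mod M ] = (+ M) ZDiv.∣ (a ℤ.- b)

_≡?_[mod_] : (a b : ℤ) (M : ℕ) → Dec (a ≡ b [mod M ])
a ≡? b [mod M ] = (+ M) ZDiv.∣? (a ℤ.- b)

Σ± : (ℤ → ℚ) → ℚ
Σ± f = f (ℤ.+ 1) ℚ.+ f (ℤ.- (ℤ.+ 1))

ℕ→ℚ : ℕ → ℚ
ℕ→ℚ n = (+ n) ℚ./ 1

wt : ℕ → ℚ
wt zero    = ½
wt (suc _) = 1ℚ

-- λ_{ℓ,m,M}(n) = Σ_± Σ*_{t>s≥0, t²-s²=n, t ≡ ±m (mod M)} (t-s)^ℓ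
-- (for such pairs t ≤ n, so t ranges over 0..n)
λc : ℕ → ℤ → ℕ → ℕ → ℚ
λc ℓ m M n = Σ± λ σ → Σ< (suc n) λ t → Σ< t λ s →
  [ ((t ℕ.* t) ℕ.≟ (n ℕ.+ s ℕ.* s)) ×-dec ((+ t) ≡? (σ ℤ.* m) [mod M ]) ]⇒
    (wt s ℚ.* ℕ→ℚ ((t ℕ.∸ s) ℕ.^ ℓ))

Λ : ℕ → ℤ → ℕ → Series
Λ = λc

-- g_{ℓ,m,M}(n) = Σ_± Σ_{d | n, 0<d<√n, d ≡ ±m (mod M)} d^ℓ   (d < √n ⇔ d² < n)
G : ℕ → ℤ → ℕ → Series
G ℓ m M n = Σ± λ σ → Σ< (suc n) λ d →
  [ (0 ℕ.<? d) ×-dec ((d NDiv.∣? n) ×-dec ((d ℕ.* d ℕ.<? n) ×-dec ((+ d) ≡? (σ ℤ.* m) [mod M ]))) ]⇒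
    ℕ→ℚ (d ℕ.^ ℓ)
  where open NP using (_<?_)

-- T_{ℓ,m,M} = Σ_± Σ_{n≥1, n ≡ ±m (mod M)} n^ℓ q^{n²}; coefficient at k
T : ℕ → ℤ → ℕ → Series
T ℓ m M k = Σ± λ σ → Σ< (suc k) λ n →
  [ (0 ℕ.<? n) ×-dec (((n ℕ.* n) ℕ.≟ k) ×-dec ((+ n) ≡? (σ ℤ.* m) [mod M ])) ]⇒
    ℕ→ℚ (n ℕ.^ ℓ)
  where open NP using (_<?_)

_∣U_ : Series → ℕ → Series
(F ∣U M) n = F (M ℕ.* n)

_⊗_ : Series → (ℕ → ℚ) → Series
(F ⊗ ψ) n = ψ n ℚ.* F n

χ₀ : ℕ → ℕ → ℚ
χ₀ M n = [ NG.gcd n M ℕ.≟ 1 ]⇒ 1ℚ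

S : Series → ℕ → ℤ → Series
S F M m n = [ (+ n) ≡? m [mod M ] ]⇒ F n

_⊕_ : Series → Series → Series
(F ⊕ H) n = F n ℚ.+ H n

_·_ : ℚ → Series → Series
(c · F) n = c ℚ.* F n

ΣS : ℕ → (ℕ → Series) → Series
ΣS N F n = Σ< N λ b → F b n

zeroS : Series
zeroS _ = 0ℚ

_≈S_ : Series → Series → Set
F ≈S H = ∀ n → F n ≡ H n

2^ : ℕ → ℚ
2^ k = ℕ→ℚ (2 ℕ.^ k)

fOf : ℕ → ℕ
fOf 1 = 0
fOf e = e

coprimeZ? : (a : ℤ) (N : ℕ) → Dec (ZG.gcd a (+ N) ≡ (+ 1))
coprimeZ? a N = ZG.gcd a (+ N) ZP.≟ + 1

{-# OPTIONS --safe #-}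
-- Both sides vanish unless n is coprime to M = 2N, N = 2^{e-1} M₁, so n is
-- odd.  The coefficient λ(4n) counts the pairs t > s ≥ 0 with t² − s² = 4n and t ≡ ±m (mod M).  If m is
-- odd, so are t and s, and then 8 ∣ t² − s² contradicts n odd.  If m = 2m₁, then t and s are even: the
-- pairs with s = 0 give the theta series T, and those with s > 0 correspond to the factorisations
-- n = d q with d < q, via t = d + q and s = q − d, the congruence becoming d + q ≡ ±2m₁ (mod M).  For
-- such d exactly one b₁ (mod N) has d ≡ ±(m₁ − b₁) (mod N); then y = ±d − m₁ + b₁ ≡ 0 (mod N) and
--   n − (m₁² − b₁²) = d (d + q ∓ 2m₁) − y (y − 2b₁),
-- which turns d + q ≡ ±2m₁ (mod M) into gcd(m₁² − b₁², N) = 1 and n ≡ m₁² − b₁² (mod 2^f M₁).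
module Submission where

open import Defs
open import Data.Nat using (ℕ; _*_; _^_; _∸_; _≥_; _+_)
open import Data.Nat.Divisibility using (_∣_)
open import Data.Integer as ℤ using (ℤ; +_)
import Data.Integer.Divisibility.Signed as ZDiv
open import Data.Rational using (½)
open import Data.Product using (_×_)
open import Relation.Nullary using (¬_)

open import Algebra.Bundles using (CommutativeMonoid)
open import Data.Empty using (⊥-elim)
open import Data.List using (_∷_; [])
open import Data.Nat as ℕ using (zero; suc; _<_; _≤_; z≤n; s≤s; NonZero; ⌊_/2⌋)
open import Data.Nat.Coprimality as NC using (Coprime)
open import Data.Nat.Divisibility
import Data.Nat.DivMod as ℕD
import Data.Nat.GCD as NG
open import Data.Nat.Primality using (euclidsLemma; prime[2])
import Data.Nat.Properties as ℕP
import Data.Nat.Tactic.RingSolver as ℕSolver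
import Data.Integer.Coprimality as ZC
import Data.Integer.DivMod as ZDM
import Data.Integer.GCD as ZG
import Data.Integer.Properties as ℤP
open import Data.Integer.Tactic.RingSolver using (solve-∀)
open import Data.Product using (_,_; proj₁; proj₂; ∃-syntax)
open import Data.Rational as ℚ using (ℚ; 0ℚ; 1ℚ; mkℚ)
import Data.Rational.Properties as ℚP
open import Data.Sum using ([_,_]′)
open import Function using (_∘_; id)
open import Function.Bundles using (_⇔_; mk⇔; Equivalence)
open import Relation.Nullary using (Dec; yes; no; _×-dec_)
open import Relation.Binary.PropositionalEquality
open import Algebra.Properties.CommutativeSemigroup
  (CommutativeMonoid.commutativeSemigroup ℚP.+-0-commutativeMonoid) using (interchange)

open ≡-Reasoning

-- Finite sums and indicators

[]⇒-true : ∀ {P : Set} (P? : Dec P) {x} → P → [ P? ]⇒ x ≡ x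
[]⇒-true (yes _) p = refl
[]⇒-true (no ¬p) p = ⊥-elim (¬p p)

[]⇒-false : ∀ {P : Set} (P? : Dec P) {x} → ¬ P → [ P? ]⇒ x ≡ 0ℚ
[]⇒-false (yes p) ¬p = ⊥-elim (¬p p)
[]⇒-false (no _) ¬p = refl

*-[]⇒ : ∀ {P : Set} (P? : Dec P) c x → c ℚ.* [ P? ]⇒ x ≡ [ P? ]⇒ (c ℚ.* x)
*-[]⇒ (yes _) c x = refl
*-[]⇒ (no _) c x = ℚP.*-zeroʳ c

[]⇒-[]⇒ : ∀ {P Q : Set} (P? : Dec P) (Q? : Dec Q) x → [ P? ]⇒ ([ Q? ]⇒ x) ≡ [ P? ×-dec Q? ]⇒ x
[]⇒-[]⇒ (yes _) (yes _) x = refl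
[]⇒-[]⇒ (yes _) (no _) x = refl
[]⇒-[]⇒ (no _) Q? x = refl

[]⇒-cong : ∀ {P Q : Set} (P? : Dec P) (Q? : Dec Q) {x} → (P → Q) → (Q → P) → [ P? ]⇒ x ≡ [ Q? ]⇒ x
[]⇒-cong P? Q? to from with P? | Q?
... | yes _ | yes _ = refl
... | yes p | no ¬q = ⊥-elim (¬q (to p))
... | no ¬p | yes q = ⊥-elim (¬p (from q))
... | no _ | no _ = refl

Σ<-cong : ∀ n {f g : ℕ → ℚ} → (∀ i → i < n → f i ≡ g i) → Σ< n f ≡ Σ< n g
Σ<-cong zero f≗g = refl
Σ<-cong (suc n) f≗g = cong₂ ℚ._+_ (Σ<-cong n λ i i<n → f≗g i (ℕP.m<n⇒m<1+n i<n)) (f≗g n ℕP.≤-refl)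

Σ<-zero : ∀ n {f : ℕ → ℚ} → (∀ i → i < n → f i ≡ 0ℚ) → Σ< n f ≡ 0ℚ
Σ<-zero zero f≗0 = refl
Σ<-zero (suc n) f≗0 =
  cong₂ ℚ._+_ (Σ<-zero n λ i i<n → f≗0 i (ℕP.m<n⇒m<1+n i<n)) (f≗0 n ℕP.≤-refl)

Σ<-+ : ∀ n (f g : ℕ → ℚ) → Σ< n (λ i → f i ℚ.+ g i) ≡ Σ< n f ℚ.+ Σ< n g
Σ<-+ zero f g = refl
Σ<-+ (suc n) f g =
  trans (cong (ℚ._+ (f n ℚ.+ g n)) (Σ<-+ n f g)) (interchange (Σ< n f) (Σ< n g) (f n) (g n))

*-Σ< : ∀ n c (f : ℕ → ℚ) → c ℚ.* Σ< n f ≡ Σ< n (λ i → c ℚ.* f i)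
*-Σ< zero c f = ℚP.*-zeroʳ c
*-Σ< (suc n) c f = trans (ℚP.*-distribˡ-+ c (Σ< n f) (f n)) (cong (ℚ._+ (c ℚ.* f n)) (*-Σ< n c f))

Σ<-comm : ∀ a b (f : ℕ → ℕ → ℚ) → Σ< a (λ i → Σ< b (f i)) ≡ Σ< b (λ j → Σ< a (λ i → f i j))
Σ<-comm zero b f = sym (Σ<-zero b λ _ _ → refl)
Σ<-comm (suc a) b f = trans (cong (ℚ._+ Σ< b (f a)) (Σ<-comm a b f)) (sym (Σ<-+ b _ (f a)))

Σ<-single : ∀ n {f : ℕ → ℚ} {i} → i < n → (∀ j → j < n → j ≢ i → f j ≡ 0ℚ) → Σ< n f ≡ f i
Σ<-single (suc n) {f} {i} i≤n f≗0 with i ℕ.≟ n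
... | yes refl = trans (cong (ℚ._+ f i) (Σ<-zero n λ j j<i → f≗0 j (ℕP.m<n⇒m<1+n j<i) (ℕP.<⇒≢ j<i)))
                       (ℚP.+-identityˡ (f i))
... | no i≢n = trans (cong₂ ℚ._+_ (Σ<-single n (ℕP.≤∧≢⇒< (ℕP.≤-pred i≤n) i≢n)
                                     λ j j<n → f≗0 j (ℕP.m<n⇒m<1+n j<n))
                                   (f≗0 n ℕP.≤-refl (i≢n ∘ sym)))
                     (ℚP.+-identityʳ (f i))

Σ<-restrict : ∀ {t} A (f : ℕ → ℚ) → t ≤ A → Σ< t f ≡ Σ< A (λ s → [ s ℕP.<? t ]⇒ f s)
Σ<-restrict zero f z≤n = refl
Σ<-restrict {t} (suc A) f t≤1+A with t ℕ.≟ suc A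
... | yes refl = Σ<-cong (suc A) λ s s<t → sym ([]⇒-true (s ℕP.<? t) s<t)
... | no t≢1+A = begin
  Σ< t f                  ≡⟨ Σ<-restrict A f t≤A ⟩
  Σ< A g                  ≡⟨ ℚP.+-identityʳ (Σ< A g) ⟨
  Σ< A g ℚ.+ 0ℚ           ≡⟨ cong (Σ< A g ℚ.+_) ([]⇒-false (A ℕP.<? t) (ℕP.≤⇒≯ t≤A)) ⟨
  Σ< A g ℚ.+ g A          ∎
  where
  g = λ s → [ s ℕP.<? t ]⇒ f s
  t≤A = ℕP.≤-pred (ℕP.≤∧≢⇒< t≤1+A t≢1+A)

[]⇒-Σ< : ∀ {P : Set} (P? : Dec P) n (f : ℕ → ℚ) → [ P? ]⇒ Σ< n f ≡ Σ< n (λ i → [ P? ]⇒ f i)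
[]⇒-Σ< (yes _) n f = refl
[]⇒-Σ< (no _) n f = sym (Σ<-zero n λ _ _ → refl)

Σ±-cong : ∀ {f g : ℤ → ℚ} → (∀ σ → σ ℤ.* σ ≡ + 1 → f σ ≡ g σ) → Σ± f ≡ Σ± g
Σ±-cong f≗g = cong₂ ℚ._+_ (f≗g (+ 1) refl) (f≗g (ℤ.- + 1) refl)

Σ±-+ : ∀ (f g : ℤ → ℚ) → Σ± (λ σ → f σ ℚ.+ g σ) ≡ Σ± f ℚ.+ Σ± g
Σ±-+ f g = interchange (f (+ 1)) (g (+ 1)) (f (ℤ.- + 1)) (g (ℤ.- + 1))

*-Σ± : ∀ c (f : ℤ → ℚ) → c ℚ.* Σ± f ≡ Σ± (λ σ → c ℚ.* f σ)
*-Σ± c f = ℚP.*-distribˡ-+ c (f (+ 1)) (f (ℤ.- + 1))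

Σ<-Σ± : ∀ n (f : ℕ → ℤ → ℚ) → Σ< n (λ i → Σ± (f i)) ≡ Σ± (λ σ → Σ< n (λ i → f i σ))
Σ<-Σ± n f = Σ<-+ n (λ i → f i (+ 1)) (λ i → f i (ℤ.- + 1))

[]⇒-Σ± : ∀ {P : Set} (P? : Dec P) (f : ℤ → ℚ) → [ P? ]⇒ Σ± f ≡ Σ± (λ σ → [ P? ]⇒ f σ)
[]⇒-Σ± (yes _) f = refl
[]⇒-Σ± (no _) f = refl

[]⇒-Σ±Σ< : ∀ {P : Set} (P? : Dec P) n {Q : ℤ → ℕ → Set} (Q? : ∀ σ i → Dec (Q σ i)) (f : ℕ → ℚ) →
           [ P? ]⇒ Σ± (λ σ → Σ< n (λ i → [ Q? σ i ]⇒ f i)) ≡ Σ± (λ σ → Σ< n (λ i → [ P? ×-dec Q? σ i ]⇒ f i))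
[]⇒-Σ±Σ< P? n Q? f = trans ([]⇒-Σ± P? λ σ → Σ< n (λ i → [ Q? σ i ]⇒ f i)) (Σ±-cong λ σ _ →
  trans ([]⇒-Σ< P? n λ i → [ Q? σ i ]⇒ f i) (Σ<-cong n λ i _ → []⇒-[]⇒ P? (Q? σ i) (f i)))

*-Σ±Σ< : ∀ c n {Q : ℤ → ℕ → Set} (Q? : ∀ σ i → Dec (Q σ i)) (f : ℕ → ℚ) →
         c ℚ.* Σ± (λ σ → Σ< n (λ i → [ Q? σ i ]⇒ f i)) ≡ Σ± (λ σ → Σ< n (λ i → [ Q? σ i ]⇒ (c ℚ.* f i)))
*-Σ±Σ< c n Q? f = trans (*-Σ± c λ σ → Σ< n (λ i → [ Q? σ i ]⇒ f i)) (Σ±-cong λ σ _ →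
  trans (*-Σ< n c λ i → [ Q? σ i ]⇒ f i) (Σ<-cong n λ i _ → *-[]⇒ (Q? σ i) c (f i)))

record PairBijection (A B : ℕ) (P : ℕ → ℕ → Set) (Q : ℕ → Set) : Set where
  field
    to : ℕ → ℕ → ℕ
    from₁ from₂ : ℕ → ℕ
    to-ok : ∀ {t s} → t < A → s < A → P t s →
            to t s < B × Q (to t s) × from₁ (to t s) ≡ t × from₂ (to t s) ≡ s
    from-ok : ∀ {j} → j < B → Q j →
              from₁ j < A × from₂ j < A × P (from₁ j) (from₂ j) × to (from₁ j) (from₂ j) ≡ j

module _ {A B P Q} (bij : PairBijection A B P Q) (P? : ∀ t s → Dec (P t s)) (Q? : ∀ j → Dec (Q j))
         (u : ℕ → ℕ → ℚ) (v : ℕ → ℚ) where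
  open PairBijection bij

  private
    w : ℕ → ℕ → ℕ → ℚ
    w t s j = [ (to t s ℕ.≟ j) ×-dec P? t s ]⇒ u t s

    w-zero : ∀ {t s j} → (to t s ≡ j → ¬ P t s) → w t s j ≡ 0ℚ
    w-zero {t} {s} {j} ¬w = []⇒-false ((to t s ℕ.≟ j) ×-dec P? t s) λ (eq , p) → ¬w eq p

    fibre : ∀ {t s j} → t < A → s < A → P t s → to t s ≡ j → from₁ j ≡ t × from₂ j ≡ s
    fibre t<A s<A p refl = proj₂ (proj₂ (to-ok t<A s<A p))

    spread : ∀ {t s} → t < A → s < A → [ P? t s ]⇒ u t s ≡ Σ< B (w t s)
    spread {t} {s} t<A s<A = by-cases (P? t s)
      where
      by-cases : Dec (P t s) → [ P? t s ]⇒ u t s ≡ Σ< B (w t s)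
      by-cases (no ¬p) = trans ([]⇒-false (P? t s) ¬p) (sym (Σ<-zero B λ j _ → w-zero λ _ p → ¬p p))
      by-cases (yes p) = begin
        [ P? t s ]⇒ u t s  ≡⟨ []⇒-true (P? t s) p ⟩
        u t s              ≡⟨ []⇒-true ((to t s ℕ.≟ to t s) ×-dec P? t s) (refl , p) ⟨
        w t s (to t s)     ≡⟨ Σ<-single B (proj₁ (to-ok t<A s<A p)) (λ j _ j≢to → w-zero λ eq _ → j≢to (sym eq)) ⟨
        Σ< B (w t s)       ∎

    collect : (∀ {j} → j < B → Q j → u (from₁ j) (from₂ j) ≡ v j) →
              ∀ j → j < B → Σ< A (λ t → Σ< A (λ s → w t s j)) ≡ [ Q? j ]⇒ v j
    collect u≡v j j<B with Q? j
    ... | no ¬q = Σ<-zero A λ t t<A → Σ<-zero A λ s s<A → w-zero λ { refl p → ¬q (proj₁ (proj₂ (to-ok t<A s<A p))) }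
    ... | yes q with from-ok j<B q
    ... | t<A , s<A , p , to≡j = begin
      Σ< A (λ t → Σ< A (λ s → w t s j)) ≡⟨ Σ<-single A t<A (λ t′ t′<A t′≢t → Σ<-zero A λ s′ s′<A →
                                               w-zero λ eq p′ → t′≢t (sym (proj₁ (fibre t′<A s′<A p′ eq)))) ⟩
      Σ< A (λ s → w (from₁ j) s j)      ≡⟨ Σ<-single A s<A (λ s′ s′<A s′≢s →
                                               w-zero λ eq p′ → s′≢s (sym (proj₂ (fibre t<A s′<A p′ eq)))) ⟩
      w (from₁ j) (from₂ j) j           ≡⟨ []⇒-true ((to (from₁ j) (from₂ j) ℕ.≟ j) ×-dec P? (from₁ j) (from₂ j)) (to≡j , p) ⟩
      u (from₁ j) (from₂ j)             ≡⟨ u≡v j<B q ⟩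
      v j                               ∎

  Σ<²-reindex : (∀ {j} → j < B → Q j → u (from₁ j) (from₂ j) ≡ v j) →
                Σ< A (λ t → Σ< A (λ s → [ P? t s ]⇒ u t s)) ≡ Σ< B (λ j → [ Q? j ]⇒ v j)
  Σ<²-reindex u≡v = begin
    Σ< A (λ t → Σ< A (λ s → [ P? t s ]⇒ u t s))       ≡⟨ Σ<-cong A (λ t t<A → Σ<-cong A (λ s s<A → spread t<A s<A)) ⟩
    Σ< A (λ t → Σ< A (λ s → Σ< B (w t s)))            ≡⟨ Σ<-cong A (λ t _ → Σ<-comm A B (w t)) ⟩
    Σ< A (λ t → Σ< B (λ j → Σ< A (λ s → w t s j)))    ≡⟨ Σ<-comm A B (λ t j → Σ< A (λ s → w t s j)) ⟩
    Σ< B (λ j → Σ< A (λ t → Σ< A (λ s → w t s j)))    ≡⟨ Σ<-cong B (collect u≡v) ⟩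
    Σ< B (λ j → [ Q? j ]⇒ v j)                        ∎

-- Arithmetic in ℕ and ℚ

^-distribʳ-* : ∀ m n ℓ → (m * n) ^ ℓ ≡ m ^ ℓ * n ^ ℓ
^-distribʳ-* m n zero = refl
^-distribʳ-* m n (suc ℓ) = trans (cong (m * n *_) (^-distribʳ-* m n ℓ)) (regroup m n (m ^ ℓ) (n ^ ℓ))
  where
  regroup : ∀ a b c d → a * b * (c * d) ≡ a * c * (b * d)
  regroup = ℕSolver.solve-∀

ℕ→ℚ-* : ∀ a b → ℕ→ℚ (a * b) ≡ ℕ→ℚ a ℚ.* ℕ→ℚ b
ℕ→ℚ-* a b = begin
  ℕ→ℚ (a * b)                   ≡⟨ cong (ℚ._/ 1) (ℤP.pos-* a b) ⟩
  (+ a ℤ.* + b) ℚ./ 1           ≡⟨ cong₂ ℚ._*_ (as-mkℚ a) (as-mkℚ b) ⟨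
  ℕ→ℚ a ℚ.* ℕ→ℚ b               ∎
  where
  as-mkℚ : ∀ n → ℕ→ℚ n ≡ mkℚ (+ n) 0 (NC.sym (NC.1-coprimeTo n))
  as-mkℚ n = ℚP.normalize-coprime (NC.sym (NC.1-coprimeTo n))

ℕ→ℚ-[d+d]^ℓ : ∀ d ℓ → ℕ→ℚ ((d + d) ^ ℓ) ≡ 2^ ℓ ℚ.* ℕ→ℚ (d ^ ℓ)
ℕ→ℚ-[d+d]^ℓ d ℓ = begin
  ℕ→ℚ ((d + d) ^ ℓ)         ≡⟨ cong (λ x → ℕ→ℚ (x ^ ℓ)) (ℕSolver.solve (d ∷ [])) ⟩
  ℕ→ℚ ((2 * d) ^ ℓ)         ≡⟨ cong ℕ→ℚ (^-distribʳ-* 2 d ℓ) ⟩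
  ℕ→ℚ (2 ^ ℓ * d ^ ℓ)       ≡⟨ ℕ→ℚ-* (2 ^ ℓ) (d ^ ℓ) ⟩
  2^ ℓ ℚ.* ℕ→ℚ (d ^ ℓ)      ∎

2∤⇒odd : ∀ {n} → 2 ∤ n → ∃[ k ] n ≡ suc (2 * k)
2∤⇒odd {n} 2∤n with n ℕ.% 2 in n%2≡r | ℕD.m%n<n n 2
... | 0 | _ = ⊥-elim (2∤n (m%n≡0⇒n∣m n 2 n%2≡r))
... | 1 | _ = n ℕ./ 2 , (begin
  n                          ≡⟨ ℕD.m≡m%n+[m/n]*n n 2 ⟩
  (n ℕ.% 2) + (n ℕ./ 2 * 2)  ≡⟨ cong₂ _+_ n%2≡r (ℕP.*-comm (n ℕ./ 2) 2) ⟩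
  suc (2 * (n ℕ./ 2))        ∎)
... | suc (suc _) | s≤s (s≤s ())

2∣n*[1+n] : ∀ n → 2 ∣ n * suc n
2∣n*[1+n] n with 2 ∣? n
... | yes 2∣n = ∣m⇒∣m*n (suc n) 2∣n
... | no 2∤n with 2∤⇒odd 2∤n
... | k , refl = ∣n⇒∣m*n n (divides (suc k) (cong (suc ∘ suc) (ℕP.*-comm 2 k)))

2∣square⇒2∣ : ∀ {n} → 2 ∣ n * n → 2 ∣ n
2∣square⇒2∣ {n} 2∣n² = [ id , id ]′ (euclidsLemma n n prime[2] 2∣n²)

2∣-square-difference : ∀ {t s} n → t * t ≡ 4 * n + s * s → 2 ∣ t ⇔ 2 ∣ s
2∣-square-difference {t} {s} n t²≡4n+s² = mk⇔
  (λ 2∣t → 2∣square⇒2∣ (∣m+n∣m⇒∣n (subst (2 ∣_) t²≡4n+s² (∣m⇒∣m*n t 2∣t)) 2∣4n))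
  (λ 2∣s → 2∣square⇒2∣ (subst (2 ∣_) (sym t²≡4n+s²) (∣m∣n⇒∣m+n 2∣4n (∣m⇒∣m*n s 2∣s))))
  where
  2∣4n : 2 ∣ 4 * n
  2∣4n = divides (2 * n) (ℕSolver.solve (n ∷ []))

odd-square-difference : ∀ {t s} n → 2 ∤ t → t * t ≡ 4 * n + s * s → 2 ∣ n
odd-square-difference {t} {s} n 2∤t t²≡4n+s² =
  pronic-difference (2∤⇒odd 2∤t) (2∤⇒odd (2∤t ∘ Equivalence.from (2∣-square-difference n t²≡4n+s²)))
  where
  pronic-difference : ∃[ a ] t ≡ suc (2 * a) → ∃[ b ] s ≡ suc (2 * b) → 2 ∣ n
  pronic-difference (a , refl) (b , refl) = ∣m+n∣m⇒∣n (subst (2 ∣_) a[1+a]≡b[1+b]+n (2∣n*[1+n] a)) (2∣n*[1+n] b)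
    where
    a[1+a]≡b[1+b]+n : a * suc a ≡ b * suc b + n
    a[1+a]≡b[1+b]+n = ℕP.*-cancelˡ-≡ _ _ 4 (ℕP.suc-injective (begin
      suc (4 * (a * suc a))              ≡⟨ ℕSolver.solve (a ∷ []) ⟩
      suc (2 * a) * suc (2 * a)          ≡⟨ t²≡4n+s² ⟩
      4 * n + suc (2 * b) * suc (2 * b)  ≡⟨ ℕSolver.solve (n ∷ b ∷ []) ⟩
      suc (4 * (b * suc b + n))          ∎))

k*2≡k+k : ∀ k → k * 2 ≡ k + k
k*2≡k+k = ℕSolver.solve-∀

<⇒∃-gap : ∀ {d q} → d < q → ∃[ e ] 0 < e × q ≡ d + e
<⇒∃-gap {d} d<q with ℕP.m≤n⇒∃[o]m+o≡n d<q
... | o , refl = suc o , s≤s z≤n , sym (ℕP.+-suc d o)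

even-gap : ∀ {t s} → s < t → 2 ∣ t → 2 ∣ s → ∃[ d ] 0 < d × t ≡ d + (d + s)
even-gap {s = s} s<t (divides-refl k) (divides-refl j) with <⇒∃-gap (ℕP.*-cancelʳ-< 2 j k s<t)
... | e , 0<e , refl = e , 0<e , regroup j e
  where
  regroup : ∀ j e → (j + e) * 2 ≡ e + (e + j * 2)
  regroup = ℕSolver.solve-∀

n≤4n : ∀ n → n ≤ 4 * n
n≤4n n = ℕP.m≤m+n n (3 * n)

n+n≤4n : ∀ n → n + n ≤ 4 * n
n+n≤4n n = ℕP.+-monoʳ-≤ n (ℕP.m≤m+n n (2 * n))

square-root≤ : ∀ {k n} → k * k ≡ n → k ≤ n
square-root≤ {zero} _ = z≤n
square-root≤ {k@(suc _)} k²≡n = subst (k ≤_) k²≡n (ℕP.m≤m*n k k)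

divisor-bounds : ∀ {n d e} → 0 < d → n ≡ (d + e) * d → d ≤ n × d + e ≤ n
divisor-bounds {d = d@(suc _)} {e} _ n≡[d+e]d =
  subst (d ≤_) (sym n≡[d+e]d) (ℕP.m≤n*m d (d + e)) , subst (d + e ≤_) (sym n≡[d+e]d) (ℕP.m≤m*n (d + e) d)

[k+k]²≡4k²+0 : ∀ k → (k + k) * (k + k) ≡ 4 * (k * k) + 0 * 0
[k+k]²≡4k²+0 = ℕSolver.solve-∀

[d+[d+e]]²≡4[d+e]d+e² : ∀ d e → (d + (d + e)) * (d + (d + e)) ≡ 4 * ((d + e) * d) + e * e
[d+[d+e]]²≡4[d+e]d+e² = ℕSolver.solve-∀

square-difference⇒factor : ∀ {n} d e → (d + (d + e)) * (d + (d + e)) ≡ 4 * n + e * e → n ≡ (d + e) * d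
square-difference⇒factor {n} d e eq =
  ℕP.*-cancelˡ-≡ _ _ 4 (ℕP.+-cancelʳ-≡ (e * e) _ _ (trans (sym eq) ([d+[d+e]]²≡4[d+e]d+e² d e)))

d+[d+e]∸e≡d+d : ∀ d e → d + (d + e) ∸ e ≡ d + d
d+[d+e]∸e≡d+d d e = trans (cong (_∸ e) (sym (ℕP.+-assoc d d e))) (ℕP.m+n∸n≡m (d + d) e)

⌊[d+[d+e]∸e]/2⌋≡d : ∀ d e → ⌊ (d + (d + e) ∸ e) /2⌋ ≡ d
⌊[d+[d+e]∸e]/2⌋≡d d e = trans (cong ⌊_/2⌋ (d+[d+e]∸e≡d+d d e)) (sym (ℕP.n≡⌊n+n/2⌋ d))

cofactor : ℕ → ℕ → ℕ
cofactor n zero = 0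
cofactor n d@(suc _) = n ℕ./ d

cofactor-* : ∀ {n d q} → 0 < d → n ≡ q * d → cofactor n d ≡ q
cofactor-* {d = suc _} {q} _ refl = ℕD.m*n/n≡m q _

-- Congruences and coprimality

-- Lets the ring solver use σ² = 1: identities are stated with an extra multiple of σ² − 1,
-- which this lemma removes.
σ²≡1⇒absorb : ∀ {σ} → σ ℤ.* σ ≡ + 1 → ∀ x r → x ℤ.+ (σ ℤ.* σ ℤ.- + 1) ℤ.* r ≡ x
σ²≡1⇒absorb {σ} σ²≡1 x r = trans (cong (λ v → x ℤ.+ (v ℤ.- + 1) ℤ.* r) σ²≡1) (x+0*r≡x x r)
  where
  x+0*r≡x : ∀ x r → x ℤ.+ (+ 1 ℤ.- + 1) ℤ.* r ≡ x
  x+0*r≡x = solve-∀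

σ*[σ*x]≡x : ∀ {σ} → σ ℤ.* σ ≡ + 1 → ∀ x → σ ℤ.* (σ ℤ.* x) ≡ x
σ*[σ*x]≡x {σ} σ²≡1 x = trans (sym (ℤP.*-assoc σ σ x)) (trans (cong (ℤ._* x) σ²≡1) (ℤP.*-identityˡ x))

∣-resp-≡[mod] : ∀ {d M a b} → + d ZDiv.∣ + M → a ≡ b [mod M ] → (+ d ZDiv.∣ a) ⇔ (+ d ZDiv.∣ b)
∣-resp-≡[mod] {a = a} {b} d∣M M∣a-b = mk⇔
  (λ d∣a → subst (_ ZDiv.∣_) (a-[a-b]≡b a b) (ZDiv.∣m∣n⇒∣m-n d∣a d∣a-b))
  (λ d∣b → subst (_ ZDiv.∣_) ([a-b]+b≡a a b) (ZDiv.∣m∣n⇒∣m+n d∣a-b d∣b))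
  where
  d∣a-b = ZDiv.∣-trans d∣M M∣a-b
  a-[a-b]≡b : ∀ a b → a ℤ.- (a ℤ.- b) ≡ b
  a-[a-b]≡b = solve-∀
  [a-b]+b≡a : ∀ a b → (a ℤ.- b) ℤ.+ b ≡ a
  [a-b]+b≡a = solve-∀

≡[mod]-*-cancel : ∀ c {N} a b .{{_ : NonZero c}} → ((+ c ℤ.* a) ≡ (+ c ℤ.* b) [mod c * N ]) ⇔ (a ≡ b [mod N ])
≡[mod]-*-cancel c {N} a b = mk⇔
  (λ cN∣ca-cb → ZDiv.*-cancelˡ-∣ (+ c) (subst₂ ZDiv._∣_ (ℤP.pos-* c N) (c*a-c*b≡c*[a-b] (+ c) a b) cN∣ca-cb))
  (λ N∣a-b → subst₂ ZDiv._∣_ (sym (ℤP.pos-* c N)) (sym (c*a-c*b≡c*[a-b] (+ c) a b)) (ZDiv.*-monoʳ-∣ (+ c) N∣a-b))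
  where
  c*a-c*b≡c*[a-b] : ∀ c a b → c ℤ.* a ℤ.- c ℤ.* b ≡ c ℤ.* (a ℤ.- b)
  c*a-c*b≡c*[a-b] = solve-∀

≡[mod]-<⇒≡ : ∀ {N b b′} → b < N → b′ < N → (+ b) ≡ (+ b′) [mod N ] → b ≡ b′
≡[mod]-<⇒≡ {N} {b} {b′} b<N b′<N N∣b-b′ =
  ℤP.+-injective (ℤP.i-j≡0⇒i≡j (+ b) (+ b′) (ℤP.∣i∣≡0⇒i≡0 (small-multiple (ZDiv.∣⇒∣ᵤ N∣b-b′) distance<N)))
  where
  distance<N : ℤ.∣ + b ℤ.- + b′ ∣ < N
  distance<N = ℕP.≤-<-trans (subst (ℕ._≤ b ℕ.⊔ b′) (cong ℤ.∣_∣ (sym (ℤP.m-n≡m⊖n b b′))) (ℤP.∣m⊝n∣≤m⊔n b b′))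
                            (ℕP.⊔-lub b<N b′<N)
  small-multiple : ∀ {x} → N ∣ x → x < N → x ≡ 0
  small-multiple {zero} _ _ = refl
  small-multiple {suc x} N∣x x<N = ⊥-elim (>⇒∤ x<N N∣x)

residue-exists : ∀ N .{{_ : NonZero N}} {σ} → σ ℤ.* σ ≡ + 1 → ∀ x m → ∃[ b ] b < N × x ≡ (σ ℤ.* (m ℤ.- + b)) [mod N ]
residue-exists N {σ} σ²≡1 x m = r , ZDM.n%ℕd<d (m ℤ.- σ ℤ.* x) N , ZDiv.divides (ℤ.- (σ ℤ.* k)) (begin
  x ℤ.- σ ℤ.* (m ℤ.- + r)                                ≡⟨ cong (λ y → x ℤ.- σ ℤ.* (m ℤ.- y)) +r≡m-σx-kN ⟩
  x ℤ.- σ ℤ.* (m ℤ.- ((m ℤ.- σ ℤ.* x) ℤ.- k ℤ.* + N))    ≡⟨ regroup x σ m k (+ N) ⟩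
  ℤ.- (σ ℤ.* k) ℤ.* + N ℤ.+ (σ ℤ.* σ ℤ.- + 1) ℤ.* ℤ.- x  ≡⟨ σ²≡1⇒absorb {σ} σ²≡1 _ (ℤ.- x) ⟩
  ℤ.- (σ ℤ.* k) ℤ.* + N                                   ∎)
  where
  r = (m ℤ.- σ ℤ.* x) ℤ.%ℕ N
  k = (m ℤ.- σ ℤ.* x) ℤ./ℕ N
  +r≡m-σx-kN : + r ≡ (m ℤ.- σ ℤ.* x) ℤ.- k ℤ.* + N
  +r≡m-σx-kN = trans (sym (move (+ r) (k ℤ.* + N))) (cong (ℤ._- k ℤ.* + N) (sym (ZDM.a≡a%ℕn+[a/ℕn]*n (m ℤ.- σ ℤ.* x) N)))
    where
    move : ∀ r y → (r ℤ.+ y) ℤ.- y ≡ r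
    move = solve-∀
  regroup : ∀ x σ m k N → x ℤ.- σ ℤ.* (m ℤ.- ((m ℤ.- σ ℤ.* x) ℤ.- k ℤ.* N))
                          ≡ ℤ.- (σ ℤ.* k) ℤ.* N ℤ.+ (σ ℤ.* σ ℤ.- + 1) ℤ.* ℤ.- x
  regroup = solve-∀

residue-unique : ∀ {N σ} → σ ℤ.* σ ≡ + 1 → ∀ {x m b b′} → b < N → b′ < N →
                 x ≡ (σ ℤ.* (m ℤ.- + b)) [mod N ] → x ≡ (σ ℤ.* (m ℤ.- + b′)) [mod N ] → b ≡ b′
residue-unique {N} {σ} σ²≡1 {x} {m} {b} {b′} b<N b′<N x≡σ[m-b] x≡σ[m-b′] =
  ≡[mod]-<⇒≡ b<N b′<N (subst (_ ZDiv.∣_) b-b′≡σ[…] (ZDiv.∣n⇒∣m*n σ (ZDiv.∣m∣n⇒∣m-n x≡σ[m-b] x≡σ[m-b′])))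
  where
  b-b′≡σ[…] : σ ℤ.* ((x ℤ.- σ ℤ.* (m ℤ.- + b)) ℤ.- (x ℤ.- σ ℤ.* (m ℤ.- + b′))) ≡ + b ℤ.- + b′
  b-b′≡σ[…] = trans (regroup x σ m (+ b) (+ b′)) (σ²≡1⇒absorb {σ} σ²≡1 (+ b ℤ.- + b′) (+ b ℤ.- + b′))
    where
    regroup : ∀ x σ m b b′ → σ ℤ.* ((x ℤ.- σ ℤ.* (m ℤ.- b)) ℤ.- (x ℤ.- σ ℤ.* (m ℤ.- b′)))
                             ≡ (b ℤ.- b′) ℤ.+ (σ ℤ.* σ ℤ.- + 1) ℤ.* (b ℤ.- b′)
    regroup = solve-∀

2∣⇔2∣-≡[mod2N] : ∀ {N t σ m} → σ ℤ.* σ ≡ + 1 → (+ t) ≡ (σ ℤ.* m) [mod 2 * N ] → 2 ∣ t ⇔ + 2 ZDiv.∣ m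
2∣⇔2∣-≡[mod2N] {N} {t} {σ} {m} σ²≡1 t≡σm = mk⇔
  (λ 2∣t → subst (_ ZDiv.∣_) (σ*[σ*x]≡x {σ} σ²≡1 m) (ZDiv.∣n⇒∣m*n σ (Equivalence.to t⇔σm (ZDiv.∣ᵤ⇒∣ 2∣t))))
  (λ 2∣m → ZDiv.∣⇒∣ᵤ (Equivalence.from t⇔σm (ZDiv.∣n⇒∣m*n σ 2∣m)))
  where
  t⇔σm = ∣-resp-≡[mod] {a = + t} {σ ℤ.* m} (ZDiv.∣ᵤ⇒∣ (m∣m*n N)) t≡σm

coprime-∣ : ∀ {m n d e} → Coprime m n → d ∣ m → e ∣ n → Coprime d e
coprime-∣ m⊥n d∣m e∣n (r∣d , r∣e) = m⊥n (∣-trans r∣d d∣m , ∣-trans r∣e e∣n)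

2∤⇒coprime-2 : ∀ {n} → 2 ∤ n → Coprime n 2
2∤⇒coprime-2 {n} 2∤n (r∣n , r∣2) = divisor-of-2 r∣2 r∣n
  where
  divisor-of-2 : ∀ {r} → r ∣ 2 → r ∣ n → r ≡ 1
  divisor-of-2 {0} 0∣2 _ with 0∣⇒≡0 0∣2
  ... | ()
  divisor-of-2 {1} _ _ = refl
  divisor-of-2 {2} _ 2∣n = ⊥-elim (2∤n 2∣n)
  divisor-of-2 {suc (suc (suc r))} r∣2 _ = ⊥-elim (>⇒∤ (s≤s (s≤s (s≤s z≤n))) r∣2)

coprime-2*⇒2∤ : ∀ {n N} → Coprime n (2 * N) → 2 ∤ n
coprime-2*⇒2∤ {N = N} n⊥2N 2∣n with n⊥2N (2∣n , m∣m*n N)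
... | ()

≡1[mod2]⇔2∤ : ∀ n → ((+ n) ≡ (+ 1) [mod 2 ]) ⇔ (2 ∤ n)
≡1[mod2]⇔2∤ n = mk⇔
  (λ n≡1 2∣n → 2∤1 (ZDiv.∣⇒∣ᵤ (Equivalence.to (∣-resp-≡[mod] {a = + n} {+ 1} ZDiv.∣-refl n≡1) (ZDiv.∣ᵤ⇒∣ 2∣n))))
  (λ 2∤n → odd⇒≡1 (2∤⇒odd 2∤n))
  where
  2∤1 : 2 ∤ 1
  2∤1 2∣1 with ∣1⇒≡1 2∣1
  ... | ()
  odd⇒≡1 : ∃[ k ] n ≡ suc (2 * k) → (+ n) ≡ (+ 1) [mod 2 ]
  odd⇒≡1 (k , refl) = ZDiv.divides (+ k) (begin
    + suc (2 * k) ℤ.- + 1       ≡⟨ cong (ℤ._- + 1) (trans (ℤP.pos-+ 1 (2 * k)) (cong (ℤ._+_ (+ 1)) (ℤP.pos-* 2 k))) ⟩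
    + 1 ℤ.+ + 2 ℤ.* + k ℤ.- + 1 ≡⟨ 1+2k-1≡k*2 (+ k) ⟩
    + k ℤ.* + 2                 ∎)
    where
    1+2k-1≡k*2 : ∀ k → + 1 ℤ.+ + 2 ℤ.* k ℤ.- + 1 ≡ k ℤ.* + 2
    1+2k-1≡k*2 = solve-∀

-- The sieving modulus

-- What the argument needs of K = 2^f M₁ relative to N = 2^{e-1} M₁: either K = N with N odd (e = 1),
-- or K = 2N with N even (e ≥ 2).
record SieveModulus (N K : ℕ) : Set where
  field
    N∣K : N ∣ K
    K∣2N : K ∣ 2 * N
    K∣y[y-2b] : ∀ {y} b → + N ZDiv.∣ y → + K ZDiv.∣ y ℤ.* (y ℤ.- + 2 ℤ.* b)
    2∣∧K∣⇒2N∣ : ∀ {z} → + 2 ZDiv.∣ z → + K ZDiv.∣ z → + (2 * N) ZDiv.∣ z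

odd-sieveModulus : ∀ {N} → 2 ∤ N → SieveModulus N N
odd-sieveModulus {N} 2∤N = record
  { N∣K = ∣-refl
  ; K∣2N = n∣m*n 2
  ; K∣y[y-2b] = λ b N∣y → ZDiv.∣m⇒∣m*n _ N∣y
  ; 2∣∧K∣⇒2N∣ = λ 2∣z N∣z → ZDiv.∣ᵤ⇒∣ (2N∣ (ZDiv.∣⇒∣ᵤ 2∣z) (ZDiv.∣⇒∣ᵤ N∣z))
  }
  where
  2N∣ : ∀ {x} → 2 ∣ x → N ∣ x → 2 * N ∣ x
  2N∣ (divides w refl) N∣2w =
    subst (2 * N ∣_) (ℕP.*-comm 2 w) (*-monoʳ-∣ 2 (NC.coprime-divisor {o = w} (2∤⇒coprime-2 2∤N) (subst (N ∣_) (ℕP.*-comm w 2) N∣2w)))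

even-sieveModulus : ∀ {N K} → 2 ∣ N → K ≡ 2 * N → SieveModulus N K
even-sieveModulus {N} (divides N′ N≡N′*2) refl = record
  { N∣K = n∣m*n 2
  ; K∣2N = ∣-refl
  ; K∣y[y-2b] = K∣y[y-2b]
  ; 2∣∧K∣⇒2N∣ = λ _ K∣z → K∣z
  }
  where
  K∣y[y-2b] : ∀ {y} b → + N ZDiv.∣ y → + (2 * N) ZDiv.∣ y ℤ.* (y ℤ.- + 2 ℤ.* b)
  K∣y[y-2b] {y} b (ZDiv.divides x y≡x*N) = ZDiv.divides (x ℤ.* (x ℤ.* + N′ ℤ.- b)) (begin
    y ℤ.* (y ℤ.- + 2 ℤ.* b)                                          ≡⟨ cong (λ y → y ℤ.* (y ℤ.- + 2 ℤ.* b)) y≡x*N ⟩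
    x ℤ.* + N ℤ.* (x ℤ.* + N ℤ.- + 2 ℤ.* b)                          ≡⟨ cong (λ N → x ℤ.* N ℤ.* (x ℤ.* N ℤ.- + 2 ℤ.* b)) +N≡+N′*2 ⟩
    x ℤ.* (+ N′ ℤ.* + 2) ℤ.* (x ℤ.* (+ N′ ℤ.* + 2) ℤ.- + 2 ℤ.* b)   ≡⟨ regroup x (+ N′) b ⟩
    x ℤ.* (x ℤ.* + N′ ℤ.- b) ℤ.* (+ 2 ℤ.* (+ N′ ℤ.* + 2))            ≡⟨ cong (λ N → x ℤ.* (x ℤ.* + N′ ℤ.- b) ℤ.* (+ 2 ℤ.* N)) +N≡+N′*2 ⟨
    x ℤ.* (x ℤ.* + N′ ℤ.- b) ℤ.* (+ 2 ℤ.* + N)                       ≡⟨ cong (x ℤ.* (x ℤ.* + N′ ℤ.- b) ℤ.*_) (ℤP.pos-* 2 N) ⟨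
    x ℤ.* (x ℤ.* + N′ ℤ.- b) ℤ.* + (2 * N)                           ∎)
    where
    +N≡+N′*2 : + N ≡ + N′ ℤ.* + 2
    +N≡+N′*2 = trans (cong +_ N≡N′*2) (ℤP.pos-* N′ 2)
    regroup : ∀ x n b → x ℤ.* (n ℤ.* + 2) ℤ.* (x ℤ.* (n ℤ.* + 2) ℤ.- + 2 ℤ.* b)
                      ≡ x ℤ.* (x ℤ.* n ℤ.- b) ℤ.* (+ 2 ℤ.* (n ℤ.* + 2))
    regroup = solve-∀

2^f-sieveModulus : ∀ e {M₁} → 2 ∤ M₁ → SieveModulus (2 ^ e * M₁) (2 ^ fOf (suc e) * M₁)
2^f-sieveModulus zero {M₁} 2∤M₁ = odd-sieveModulus (2∤M₁ ∘ subst (2 ∣_) (ℕP.*-identityˡ M₁))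
2^f-sieveModulus (suc e) {M₁} _ =
  even-sieveModulus (divides (2 ^ e * M₁) (trans (ℕP.*-assoc 2 (2 ^ e) M₁) (ℕP.*-comm 2 (2 ^ e * M₁))))
                    (ℕP.*-assoc 2 (2 ^ suc e) M₁)

module _ {N K} (sieve : SieveModulus N K) where
  open SieveModulus sieve

  coprime-if-sieved : ∀ {n} a → ZG.gcd a (+ N) ≡ + 1 → (+ n) ≡ (+ 1) [mod 2 ] → (+ n) ≡ a [mod K ] →
                      Coprime n (2 * N)
  coprime-if-sieved {n} a gcd[a,N]≡1 n≡1 n≡a {p} (p∣n , p∣2N) =
    NC.gcd≡1⇒coprime (ℤP.+-injective gcd[a,N]≡1) (ZDiv.∣⇒∣ᵤ p∣a , p∣N)
    where
    p∣N : p ∣ N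
    p∣N = NC.coprime-divisor (coprime-∣ (2∤⇒coprime-2 (Equivalence.to (≡1[mod2]⇔2∤ n) n≡1)) p∣n ∣-refl) p∣2N
    p∣a : + p ZDiv.∣ a
    p∣a = Equivalence.to (∣-resp-≡[mod] {a = + n} {a} (ZDiv.∣ᵤ⇒∣ (∣-trans p∣N N∣K)) n≡a) (ZDiv.∣ᵤ⇒∣ p∣n)

  module _ {n d q} (n≡d*q : n ≡ d * q) (n⊥2N : Coprime n (2 * N)) {σ} (σ²≡1 : σ ℤ.* σ ≡ + 1) (m₁ b : ℤ)
           (d≡σ[m₁-b] : (+ d) ≡ (σ ℤ.* (m₁ ℤ.- b)) [mod N ]) where

    private
      a y z : ℤ
      a = m₁ ℤ.* m₁ ℤ.- b ℤ.* b
      y = σ ℤ.* + d ℤ.- m₁ ℤ.+ b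
      z = + (d + q) ℤ.- σ ℤ.* (+ 2 ℤ.* m₁)

    n-a≡dz-y[y-2b] : + n ℤ.- a ≡ + d ℤ.* z ℤ.- y ℤ.* (y ℤ.- + 2 ℤ.* b)
    n-a≡dz-y[y-2b] = begin
      + n ℤ.- a                                                          ≡⟨ cong (ℤ._- a) (trans (cong +_ n≡d*q) (ℤP.pos-* d q)) ⟩
      + d ℤ.* + q ℤ.- a                                                  ≡⟨ σ²≡1⇒absorb {σ} σ²≡1 _ (ℤ.- (+ d ℤ.* + d)) ⟨
      (+ d ℤ.* + q ℤ.- a) ℤ.+ (σ ℤ.* σ ℤ.- + 1) ℤ.* ℤ.- (+ d ℤ.* + d)   ≡⟨ expand (+ d) (+ q) σ m₁ b ⟩
      + d ℤ.* ((+ d ℤ.+ + q) ℤ.- σ ℤ.* (+ 2 ℤ.* m₁)) ℤ.- y ℤ.* (y ℤ.- + 2 ℤ.* b)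
        ≡⟨ cong (λ s → + d ℤ.* (s ℤ.- σ ℤ.* (+ 2 ℤ.* m₁)) ℤ.- y ℤ.* (y ℤ.- + 2 ℤ.* b)) (ℤP.pos-+ d q) ⟨
      + d ℤ.* z ℤ.- y ℤ.* (y ℤ.- + 2 ℤ.* b)                              ∎
      where
      expand : ∀ d q σ m b →
        (d ℤ.* q ℤ.- (m ℤ.* m ℤ.- b ℤ.* b)) ℤ.+ (σ ℤ.* σ ℤ.- + 1) ℤ.* ℤ.- (d ℤ.* d)
          ≡ d ℤ.* ((d ℤ.+ q) ℤ.- σ ℤ.* (+ 2 ℤ.* m)) ℤ.- (σ ℤ.* d ℤ.- m ℤ.+ b) ℤ.* ((σ ℤ.* d ℤ.- m ℤ.+ b) ℤ.- + 2 ℤ.* b)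
      expand = solve-∀

    N∣y : + N ZDiv.∣ y
    N∣y = ZDiv.divides (σ ℤ.* k) (begin
      y                                                                      ≡⟨ regroup (+ d) σ m₁ b ⟩
      σ ℤ.* (+ d ℤ.- σ ℤ.* (m₁ ℤ.- b)) ℤ.+ (σ ℤ.* σ ℤ.- + 1) ℤ.* (m₁ ℤ.- b) ≡⟨ σ²≡1⇒absorb {σ} σ²≡1 _ (m₁ ℤ.- b) ⟩
      σ ℤ.* (+ d ℤ.- σ ℤ.* (m₁ ℤ.- b))                                       ≡⟨ cong (σ ℤ.*_) d-σ[m₁-b]≡k*N ⟩
      σ ℤ.* (k ℤ.* + N)                                                      ≡⟨ ℤP.*-assoc σ k (+ N) ⟨
      σ ℤ.* k ℤ.* + N                                                        ∎)
      where
      open ZDiv._∣_ d≡σ[m₁-b] renaming (quotient to k; equality to d-σ[m₁-b]≡k*N)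
      regroup : ∀ d σ m b → σ ℤ.* d ℤ.- m ℤ.+ b ≡ σ ℤ.* (d ℤ.- σ ℤ.* (m ℤ.- b)) ℤ.+ (σ ℤ.* σ ℤ.- + 1) ℤ.* (m ℤ.- b)
      regroup = solve-∀

    2∣z : + 2 ZDiv.∣ z
    2∣z = ZDiv.∣m∣n⇒∣m-n (ZDiv.∣ᵤ⇒∣ {+ 2} {+ (d + q)} (odd+odd (2∤⇒odd 2∤d) (2∤⇒odd 2∤q)))
                         (ZDiv.∣n⇒∣m*n σ (ZDiv.∣m⇒∣m*n m₁ ZDiv.∣-refl))
      where
      2∤n = coprime-2*⇒2∤ {n} {N} n⊥2N
      2∤d : 2 ∤ d
      2∤d 2∣d = 2∤n (subst (2 ∣_) (sym n≡d*q) (∣m⇒∣m*n q 2∣d))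
      2∤q : 2 ∤ q
      2∤q 2∣q = 2∤n (subst (2 ∣_) (sym n≡d*q) (∣n⇒∣m*n d 2∣q))
      odd+odd : ∃[ i ] d ≡ suc (2 * i) → ∃[ j ] q ≡ suc (2 * j) → 2 ∣ d + q
      odd+odd (i , refl) (j , refl) = divides (suc (i + j)) (ℕSolver.solve (i ∷ j ∷ []))

    K∣n-a⇔K∣z : (+ K ZDiv.∣ + n ℤ.- a) ⇔ (+ K ZDiv.∣ z)
    K∣n-a⇔K∣z = mk⇔
      (λ K∣n-a → ZDiv.∣ᵤ⇒∣ (ZC.coprime-divisor (+ K) (+ d) z K⊥d (ZDiv.∣⇒∣ᵤ (Equivalence.to n-a⇔dz K∣n-a))))
      (λ K∣z → Equivalence.from n-a⇔dz (ZDiv.∣n⇒∣m*n (+ d) K∣z))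
      where
      K⊥d : Coprime K d
      K⊥d = NC.sym (coprime-∣ n⊥2N (divides q (trans n≡d*q (ℕP.*-comm d q))) K∣2N)
      [u-v]-u≡-v : ∀ u v → (u ℤ.- v) ℤ.- u ≡ ℤ.- v
      [u-v]-u≡-v = solve-∀
      n-a≡dz : (+ n ℤ.- a) ≡ (+ d ℤ.* z) [mod K ]
      n-a≡dz = subst (+ K ZDiv.∣_) (sym (trans (cong (ℤ._- + d ℤ.* z) n-a≡dz-y[y-2b]) ([u-v]-u≡-v (+ d ℤ.* z) (y ℤ.* (y ℤ.- + 2 ℤ.* b)))))
                     (ZDiv.∣m⇒∣-m (K∣y[y-2b] b N∣y))
      n-a⇔dz = ∣-resp-≡[mod] {a = + n ℤ.- a} {+ d ℤ.* z} ZDiv.∣-refl n-a≡dz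

    sieve-condition⇔ : (ZG.gcd a (+ N) ≡ + 1 × ((+ n) ≡ a [mod K ])) ⇔ ((+ (d + q)) ≡ (σ ℤ.* (+ 2 ℤ.* m₁)) [mod 2 * N ])
    sieve-condition⇔ = mk⇔
      (λ (_ , K∣n-a) → 2∣∧K∣⇒2N∣ 2∣z (Equivalence.to K∣n-a⇔K∣z K∣n-a))
      (λ 2N∣z → let K∣n-a = Equivalence.from K∣n-a⇔K∣z (ZDiv.∣-trans (ZDiv.∣ᵤ⇒∣ K∣2N) 2N∣z)
                in gcd[a,N]≡1 K∣n-a , K∣n-a)
      where
      gcd[a,N]≡1 : + K ZDiv.∣ + n ℤ.- a → ZG.gcd a (+ N) ≡ + 1
      gcd[a,N]≡1 K∣n-a = cong +_ (NC.coprime⇒gcd≡1 λ {p} (p∣a , p∣N) →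
        n⊥2N (ZDiv.∣⇒∣ᵤ (Equivalence.from (∣-resp-≡[mod] {a = + n} {a} (ZDiv.∣ᵤ⇒∣ (∣-trans p∣N N∣K)) K∣n-a) (ZDiv.∣ᵤ⇒∣ p∣a)) ,
              ∣-trans p∣N (n∣m*n 2)))

-- Coefficients of Λ

Λ-Pair : ℤ → ℕ → ℕ → ℤ → ℕ → ℕ → Set
Λ-Pair m M n σ t s = t * t ≡ n + s * s × ((+ t) ≡ (σ ℤ.* m) [mod M ])

Λ-pair? : ∀ m M n σ t s → Dec (Λ-Pair m M n σ t s)
Λ-pair? m M n σ t s = ((t * t) ℕ.≟ (n + s * s)) ×-dec ((+ t) ≡? (σ ℤ.* m) [mod M ])

Λσ : ℕ → ℤ → ℕ → ℕ → ℤ → ℚ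
Λσ ℓ m M n σ = Σ< (suc n) λ t → Σ< t λ s → [ Λ-pair? m M n σ t s ]⇒ (wt s ℚ.* ℕ→ℚ ((t ∸ s) ^ ℓ))

χ₀-coprime : ∀ {M n} → NG.gcd n M ≡ 1 → ∀ x → χ₀ M n ℚ.* x ≡ x
χ₀-coprime {M} {n} gcd≡1 x = trans (cong (ℚ._* x) ([]⇒-true (NG.gcd n M ℕ.≟ 1) gcd≡1)) (ℚP.*-identityˡ x)

χ₀-non-coprime : ∀ {M n} → NG.gcd n M ≢ 1 → ∀ x → χ₀ M n ℚ.* x ≡ 0ℚ
χ₀-non-coprime {M} {n} gcd≢1 x = trans (cong (ℚ._* x) ([]⇒-false (NG.gcd n M ℕ.≟ 1) gcd≢1)) (ℚP.*-zeroˡ x)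

Λ∣U4⊗χ₀-odd≈0 : ∀ ℓ {N M} → M ≡ 2 * N → ∀ m → ¬ (+ 2 ZDiv.∣ m) → ((Λ ℓ m M ∣U 4) ⊗ χ₀ M) ≈S zeroS
Λ∣U4⊗χ₀-odd≈0 ℓ {N} refl m 2∤m n with NG.gcd n (2 * N) ℕ.≟ 1
... | no gcd≢1 = χ₀-non-coprime {2 * N} {n} gcd≢1 _
... | yes gcd≡1 = trans (χ₀-coprime {2 * N} {n} gcd≡1 _) (Σ±-cong {Λσ ℓ m (2 * N) (4 * n)} {λ _ → 0ℚ} λ σ σ²≡1 →
        Σ<-zero (suc (4 * n)) λ t _ → Σ<-zero t λ s _ → []⇒-false (Λ-pair? m (2 * N) (4 * n) σ t s) (no-pair {σ} {t} {s} σ²≡1))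
  where
  no-pair : ∀ {σ t s} → σ ℤ.* σ ≡ + 1 → ¬ Λ-Pair m (2 * N) (4 * n) σ t s
  no-pair {σ} {t} {s} σ²≡1 (t²≡4n+s² , t≡σm) = coprime-2*⇒2∤ {N = N} (NC.gcd≡1⇒coprime gcd≡1)
    (odd-square-difference {t} {s} n (2∤m ∘ Equivalence.to (2∣⇔2∣-≡[mod2N] {N} {t} {σ} σ²≡1 t≡σm)) t²≡4n+s²)

module EvenCoefficient (ℓ N K : ℕ) (m₁ : ℤ) (n : ℕ) where

  private
    m : ℤ
    m = + 2 ℤ.* m₁
    A : ℕ
    A = suc (4 * n)
    u : ℕ → ℕ → ℚ
    u t s = ℕ→ℚ ((t ∸ s) ^ ℓ)
    a : ℕ → ℤ
    a b = m₁ ℤ.* m₁ ℤ.- + b ℤ.* + b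

  Pair₀ Pair₊ : ℤ → ℕ → ℕ → Set
  Pair₀ σ t s = (s < t × Λ-Pair m (2 * N) (4 * n) σ t s) × s ≡ 0
  Pair₊ σ t s = (s < t × Λ-Pair m (2 * N) (4 * n) σ t s) × 0 < s

  pair₀? : ∀ σ t s → Dec (Pair₀ σ t s)
  pair₀? σ t s = ((s ℕP.<? t) ×-dec Λ-pair? m (2 * N) (4 * n) σ t s) ×-dec (s ℕ.≟ 0)

  pair₊? : ∀ σ t s → Dec (Pair₊ σ t s)
  pair₊? σ t s = ((s ℕP.<? t) ×-dec Λ-pair? m (2 * N) (4 * n) σ t s) ×-dec (0 ℕP.<? s)

  term₀ term₊ : ℤ → ℕ → ℕ → ℚ
  term₀ σ t s = [ pair₀? σ t s ]⇒ (½ ℚ.* u t s)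
  term₊ σ t s = [ pair₊? σ t s ]⇒ u t s

  Λσ-split : ∀ σ → Λσ ℓ m (2 * N) (4 * n) σ ≡ Σ< A (λ t → Σ< A (term₀ σ t)) ℚ.+ Σ< A (λ t → Σ< A (term₊ σ t))
  Λσ-split σ = begin
    Λσ ℓ m (2 * N) (4 * n) σ
      ≡⟨ Σ<-cong A (λ t t<A → Σ<-restrict A (λ s → [ pair? t s ]⇒ (wt s ℚ.* u t s)) (ℕP.<⇒≤ t<A)) ⟩
    Σ< A (λ t → Σ< A (λ s → [ s ℕP.<? t ]⇒ ([ pair? t s ]⇒ (wt s ℚ.* u t s))))
      ≡⟨ Σ<-cong A (λ t _ → Σ<-cong A (λ s _ → trans ([]⇒-[]⇒ (s ℕP.<? t) (pair? t s) (wt s ℚ.* u t s)) (by-weight t s))) ⟩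
    Σ< A (λ t → Σ< A (λ s → term₀ σ t s ℚ.+ term₊ σ t s))
      ≡⟨ Σ<-cong A (λ t _ → Σ<-+ A (term₀ σ t) (term₊ σ t)) ⟩
    Σ< A (λ t → Σ< A (term₀ σ t) ℚ.+ Σ< A (term₊ σ t))
      ≡⟨ Σ<-+ A (λ t → Σ< A (term₀ σ t)) (λ t → Σ< A (term₊ σ t)) ⟩
    Σ< A (λ t → Σ< A (term₀ σ t)) ℚ.+ Σ< A (λ t → Σ< A (term₊ σ t)) ∎
    where
    pair? = Λ-pair? m (2 * N) (4 * n) σ
    by-weight : ∀ t s → [ (s ℕP.<? t) ×-dec pair? t s ]⇒ (wt s ℚ.* u t s) ≡ term₀ σ t s ℚ.+ term₊ σ t s
    by-weight t zero = begin
      [ (0 ℕP.<? t) ×-dec pair? t 0 ]⇒ (½ ℚ.* u t 0)  ≡⟨ []⇒-cong ((0 ℕP.<? t) ×-dec pair? t 0) (pair₀? σ t 0) (_, refl) proj₁ ⟩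
      term₀ σ t 0                                      ≡⟨ ℚP.+-identityʳ (term₀ σ t 0) ⟨
      term₀ σ t 0 ℚ.+ 0ℚ                               ≡⟨ cong (term₀ σ t 0 ℚ.+_) ([]⇒-false (pair₊? σ t 0) λ ()) ⟨
      term₀ σ t 0 ℚ.+ term₊ σ t 0                      ∎
    by-weight t s@(suc _) = begin
      [ (s ℕP.<? t) ×-dec pair? t s ]⇒ (1ℚ ℚ.* u t s)  ≡⟨ cong ([ (s ℕP.<? t) ×-dec pair? t s ]⇒_) (ℚP.*-identityˡ (u t s)) ⟩
      [ (s ℕP.<? t) ×-dec pair? t s ]⇒ u t s           ≡⟨ []⇒-cong ((s ℕP.<? t) ×-dec pair? t s) (pair₊? σ t s) (_, s≤s z≤n) proj₁ ⟩
      term₊ σ t s                                       ≡⟨ ℚP.+-identityˡ (term₊ σ t s) ⟨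
      0ℚ ℚ.+ term₊ σ t s                                ≡⟨ cong (ℚ._+ term₊ σ t s) ([]⇒-false (pair₀? σ t s) λ ()) ⟨
      term₀ σ t s ℚ.+ term₊ σ t s                       ∎

  ≡σm⇒even : ∀ {σ t} → σ ℤ.* σ ≡ + 1 → (+ t) ≡ (σ ℤ.* m) [mod 2 * N ] → ∃[ k ] t ≡ k + k
  ≡σm⇒even {σ} {t} σ²≡1 t≡σm =
    let divides k t≡k*2 = Equivalence.from (2∣⇔2∣-≡[mod2N] {N} {t} {σ} σ²≡1 t≡σm) (ZDiv.∣m⇒∣m*n m₁ ZDiv.∣-refl)
    in k , trans t≡k*2 (k*2≡k+k k)

  double-≡[mod]⇔ : ∀ σ k → (+ (k + k)) ≡ (σ ℤ.* m) [mod 2 * N ] ⇔ (+ k) ≡ (σ ℤ.* m₁) [mod N ]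
  double-≡[mod]⇔ σ k = subst (λ x → x ⇔ ((+ k) ≡ (σ ℤ.* m₁) [mod N ]))
                        (cong₂ (λ x y → x ≡ y [mod 2 * N ]) (2*k≡k+k (+ k)) (2*[σ*m₁]≡σ*[2*m₁] σ m₁))
                        (≡[mod]-*-cancel 2 (+ k) (σ ℤ.* m₁))
    where
    2*k≡k+k : ∀ k → + 2 ℤ.* k ≡ k ℤ.+ k
    2*k≡k+k = solve-∀
    2*[σ*m₁]≡σ*[2*m₁] : ∀ σ m₁ → + 2 ℤ.* (σ ℤ.* m₁) ≡ σ ℤ.* (+ 2 ℤ.* m₁)
    2*[σ*m₁]≡σ*[2*m₁] = solve-∀

  Root : ℤ → ℕ → Set
  Root σ k = 0 < k × (k * k ≡ n × ((+ k) ≡ (σ ℤ.* m₁) [mod N ]))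

  root? : ∀ σ k → Dec (Root σ k)
  root? σ k = (0 ℕP.<? k) ×-dec (((k * k) ℕ.≟ n) ×-dec ((+ k) ≡? (σ ℤ.* m₁) [mod N ]))

  root⇒pair₀ : ∀ {σ k} → Root σ k → k + k < A × 0 < A × Pair₀ σ (k + k) 0 × ⌊ k + k /2⌋ ≡ k
  root⇒pair₀ {σ} {k} (0<k , k²≡n , k≡σm₁) =
    s≤s (ℕP.≤-trans (ℕP.+-mono-≤ {k} {n} {k} {n} k≤n k≤n) (n+n≤4n n)) ,
    s≤s z≤n ,
    ((ℕP.<-≤-trans 0<k (ℕP.m≤m+n k k) ,
      trans ([k+k]²≡4k²+0 k) (cong (λ x → 4 * x + 0) k²≡n) ,
      Equivalence.from (double-≡[mod]⇔ σ k) k≡σm₁) ,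
     refl) ,
    sym (ℕP.n≡⌊n+n/2⌋ k)
    where
    k≤n = square-root≤ {k} k²≡n

  pair₀⇒root : ∀ {σ t s} → σ ℤ.* σ ≡ + 1 → Pair₀ σ t s →
                ⌊ t /2⌋ < suc n × Root σ ⌊ t /2⌋ × ⌊ t /2⌋ + ⌊ t /2⌋ ≡ t × 0 ≡ s
  pair₀⇒root {σ} {t} σ²≡1 ((0<t , t²≡4n+0 , t≡σm) , refl) = halve (≡σm⇒even {σ} {t} σ²≡1 t≡σm) 0<t t²≡4n+0 t≡σm
    where
    halve : ∀ {t} → ∃[ k ] t ≡ k + k → 0 < t → t * t ≡ 4 * n + 0 * 0 → (+ t) ≡ (σ ℤ.* m) [mod 2 * N ] →
            ⌊ t /2⌋ < suc n × Root σ ⌊ t /2⌋ × ⌊ t /2⌋ + ⌊ t /2⌋ ≡ t × 0 ≡ 0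
    halve (k , refl) 0<t t²≡4n+0 t≡σm =
      subst (λ h → h < suc n × Root σ h × h + h ≡ k + k × 0 ≡ 0) (ℕP.n≡⌊n+n/2⌋ k)
            (s≤s (square-root≤ {k} k²≡n) , (0<k , k²≡n , Equivalence.to (double-≡[mod]⇔ σ k) t≡σm) , refl , refl)
      where
      k²≡n : k * k ≡ n
      k²≡n = ℕP.*-cancelˡ-≡ (k * k) n 4 (ℕP.+-cancelʳ-≡ 0 (4 * (k * k)) (4 * n) (trans (sym ([k+k]²≡4k²+0 k)) t²≡4n+0))
      0<k : 0 < k
      0<k = ℕP.n≢0⇒n>0 λ { refl → ℕP.<-irrefl refl 0<t }

  pair₀-bijection : ∀ {σ} → σ ℤ.* σ ≡ + 1 → PairBijection A (suc n) (Pair₀ σ) (Root σ)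
  pair₀-bijection {σ} σ²≡1 = record
    { to = λ t _ → ⌊ t /2⌋
    ; from₁ = λ k → k + k
    ; from₂ = λ _ → 0
    ; to-ok = λ {t} {s} _ _ → pair₀⇒root {σ} {t} {s} σ²≡1
    ; from-ok = λ {k} _ → root⇒pair₀ {σ} {k}
    }

  SmallDivisor : ℤ → ℕ → Set
  SmallDivisor σ d = 0 < d × (d ∣ n × (d * d < n × ((+ (d + cofactor n d)) ≡ (σ ℤ.* m) [mod 2 * N ])))

  smallDivisor? : ∀ σ d → Dec (SmallDivisor σ d)
  smallDivisor? σ d = (0 ℕP.<? d) ×-dec ((d ∣? n) ×-dec ((d * d ℕP.<? n) ×-dec ((+ (d + cofactor n d)) ≡? (σ ℤ.* m) [mod 2 * N ])))

  smallDivisor-cofactor : ∀ {σ d} → SmallDivisor σ d → ∃[ e ] 0 < e × cofactor n d ≡ d + e × n ≡ (d + e) * d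
  smallDivisor-cofactor {d = d} (0<d , divides q n≡q*d , d²<n , _) =
    let e , 0<e , q≡d+e = <⇒∃-gap (ℕP.*-cancelʳ-< d d q (subst (d * d <_) n≡q*d d²<n))
    in e , 0<e , trans (cofactor-* 0<d n≡q*d) q≡d+e , trans n≡q*d (cong (_* d) q≡d+e)

  smallDivisor-gap : ∀ {σ d} → SmallDivisor σ d → d + cofactor n d ∸ (cofactor n d ∸ d) ≡ d + d
  smallDivisor-gap {σ} {d} small = gap (smallDivisor-cofactor {σ} {d} small)
    where
    gap : ∃[ e ] 0 < e × cofactor n d ≡ d + e × n ≡ (d + e) * d → d + cofactor n d ∸ (cofactor n d ∸ d) ≡ d + d
    gap (e , _ , q≡d+e , _) = begin
      d + cofactor n d ∸ (cofactor n d ∸ d)  ≡⟨ cong (λ q → d + q ∸ (q ∸ d)) q≡d+e ⟩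
      d + (d + e) ∸ (d + e ∸ d)              ≡⟨ cong (d + (d + e) ∸_) (ℕP.m+n∸m≡n d e) ⟩
      d + (d + e) ∸ e                        ≡⟨ d+[d+e]∸e≡d+d d e ⟩
      d + d                                  ∎

  smallDivisor⇒pair₊ : ∀ {σ d} → SmallDivisor σ d →
                  d + cofactor n d < A × cofactor n d ∸ d < A × Pair₊ σ (d + cofactor n d) (cofactor n d ∸ d) ×
                  ⌊ (d + cofactor n d ∸ (cofactor n d ∸ d)) /2⌋ ≡ d
  smallDivisor⇒pair₊ {σ} {d} small@(0<d , _ , _ , d+q≡σm) = from-gap (smallDivisor-cofactor {σ} {d} small)
    where
    from-gap : ∃[ e ] 0 < e × cofactor n d ≡ d + e × n ≡ (d + e) * d →
               d + cofactor n d < A × cofactor n d ∸ d < A × Pair₊ σ (d + cofactor n d) (cofactor n d ∸ d) ×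
               ⌊ (d + cofactor n d ∸ (cofactor n d ∸ d)) /2⌋ ≡ d
    from-gap (e , 0<e , q≡d+e , n≡[d+e]d) =
      subst₂ (λ q r → d + q < A × r < A × Pair₊ σ (d + q) r × ⌊ (d + q ∸ r) /2⌋ ≡ d) (sym q≡d+e) (sym r≡e)
        (s≤s (ℕP.≤-trans (ℕP.+-mono-≤ {d} {n} {d + e} {n} d≤n d+e≤n) (n+n≤4n n)) ,
         s≤s (ℕP.≤-trans (ℕP.m≤n+m e d) (ℕP.≤-trans d+e≤n (n≤4n n))) ,
         ((ℕP.<-≤-trans (ℕP.m<n+m e 0<d) (ℕP.m≤n+m (d + e) d) ,
           trans ([d+[d+e]]²≡4[d+e]d+e² d e) (cong (λ x → 4 * x + e * e) (sym n≡[d+e]d)) ,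
           subst (λ q → (+ (d + q)) ≡ (σ ℤ.* m) [mod 2 * N ]) q≡d+e d+q≡σm) ,
          0<e) ,
         ⌊[d+[d+e]∸e]/2⌋≡d d e)
      where
      r≡e : cofactor n d ∸ d ≡ e
      r≡e = trans (cong (_∸ d) q≡d+e) (ℕP.m+n∸m≡n d e)
      d≤n = proj₁ (divisor-bounds {n} {d} {e} 0<d n≡[d+e]d)
      d+e≤n = proj₂ (divisor-bounds {n} {d} {e} 0<d n≡[d+e]d)

  pair₊⇒smallDivisor : ∀ {σ t s} → σ ℤ.* σ ≡ + 1 → Pair₊ σ t s →
                  ⌊ (t ∸ s) /2⌋ < suc n × SmallDivisor σ ⌊ (t ∸ s) /2⌋ ×
                  ⌊ (t ∸ s) /2⌋ + cofactor n ⌊ (t ∸ s) /2⌋ ≡ t × cofactor n ⌊ (t ∸ s) /2⌋ ∸ ⌊ (t ∸ s) /2⌋ ≡ s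
  pair₊⇒smallDivisor {σ} {t} {s} σ²≡1 ((s<t , t²≡4n+s² , t≡σm) , 0<s) =
    split-gap (even-gap s<t 2∣t (Equivalence.to (2∣-square-difference {t} {s} n t²≡4n+s²) 2∣t)) t²≡4n+s² t≡σm
    where
    2∣t : 2 ∣ t
    2∣t = let k , t≡k+k = ≡σm⇒even {σ} {t} σ²≡1 t≡σm in divides k (trans t≡k+k (sym (k*2≡k+k k)))

    split-gap : ∀ {t} → ∃[ d ] 0 < d × t ≡ d + (d + s) → t * t ≡ 4 * n + s * s → (+ t) ≡ (σ ℤ.* m) [mod 2 * N ] →
                ⌊ (t ∸ s) /2⌋ < suc n × SmallDivisor σ ⌊ (t ∸ s) /2⌋ ×
                ⌊ (t ∸ s) /2⌋ + cofactor n ⌊ (t ∸ s) /2⌋ ≡ t × cofactor n ⌊ (t ∸ s) /2⌋ ∸ ⌊ (t ∸ s) /2⌋ ≡ s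
    split-gap (d , 0<d , refl) t²≡4n+s² t≡σm =
      subst (λ h → h < suc n × SmallDivisor σ h × h + cofactor n h ≡ d + (d + s) × cofactor n h ∸ h ≡ s)
            (sym (⌊[d+[d+e]∸e]/2⌋≡d d s))
            (s≤s (proj₁ (divisor-bounds {n} {d} {s} 0<d n≡[d+s]d)) ,
             (0<d , divides (d + s) n≡[d+s]d ,
              subst (d * d <_) (sym n≡[d+s]d) (ℕP.*-monoˡ-< d {{ℕ.>-nonZero 0<d}} (ℕP.m<m+n d 0<s)) ,
              subst (λ q → (+ (d + q)) ≡ (σ ℤ.* m) [mod 2 * N ]) (sym q≡d+s) t≡σm) ,
             cong (_+_ d) q≡d+s ,
             trans (cong (_∸ d) q≡d+s) (ℕP.m+n∸m≡n d s))
      where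
      n≡[d+s]d = square-difference⇒factor {n} d s t²≡4n+s²
      q≡d+s = cofactor-* 0<d n≡[d+s]d

  pair₊-bijection : ∀ {σ} → σ ℤ.* σ ≡ + 1 → PairBijection A (suc n) (Pair₊ σ) (SmallDivisor σ)
  pair₊-bijection {σ} σ²≡1 = record
    { to = λ t s → ⌊ (t ∸ s) /2⌋
    ; from₁ = λ d → d + cofactor n d
    ; from₂ = λ d → cofactor n d ∸ d
    ; to-ok = λ {t} {s} _ _ → pair₊⇒smallDivisor {σ} {t} {s} σ²≡1
    ; from-ok = λ {d} _ → smallDivisor⇒pair₊ {σ} {d}
    }

  GDivisor : ℕ → ℤ → ℕ → Set
  GDivisor b σ d = 0 < d × (d ∣ n × (d * d < n × ((+ d) ≡ (σ ℤ.* (m₁ ℤ.- + b)) [mod N ])))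

  gDivisor? : ∀ b σ d → Dec (GDivisor b σ d)
  gDivisor? b σ d = (0 ℕP.<? d) ×-dec ((d ∣? n) ×-dec ((d * d ℕP.<? n) ×-dec ((+ d) ≡? (σ ℤ.* (m₁ ℤ.- + b)) [mod N ])))

  Sieved : ℤ → ℕ → ℕ → Set
  Sieved σ b d = ZG.gcd (a b) (+ N) ≡ + 1 × (((+ n) ≡ a b [mod K ]) × GDivisor b σ d)

  sieved? : ∀ σ b d → Dec (Sieved σ b d)
  sieved? σ b d = coprimeZ? (a b) N ×-dec (((+ n) ≡? a b [mod K ]) ×-dec gDivisor? b σ d)

  Σ-sieved≡smallDivisor : .{{_ : NonZero N}} → SieveModulus N K → Coprime n (2 * N) → ∀ {σ} → σ ℤ.* σ ≡ + 1 → ∀ d x →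
                    Σ< N (λ b → [ sieved? σ b d ]⇒ x) ≡ [ smallDivisor? σ d ]⇒ x
  Σ-sieved≡smallDivisor sieve n⊥2N {σ} σ²≡1 d x = by-cases ((0 ℕP.<? d) ×-dec ((d ∣? n) ×-dec (d * d ℕP.<? n)))
    where
    by-cases : Dec (0 < d × d ∣ n × d * d < n) → Σ< N (λ b → [ sieved? σ b d ]⇒ x) ≡ [ smallDivisor? σ d ]⇒ x
    by-cases (no ¬divisor) =
      trans (Σ<-zero N {λ b → [ sieved? σ b d ]⇒ x} λ b _ →
               []⇒-false (sieved? σ b d) {x} λ (_ , _ , 0<d , d∣n , d²<n , _) → ¬divisor (0<d , d∣n , d²<n))
            (sym ([]⇒-false (smallDivisor? σ d) {x} λ (0<d , d∣n , d²<n , _) → ¬divisor (0<d , d∣n , d²<n)))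
    by-cases (yes (0<d , d∣n@(divides q n≡q*d) , d²<n)) =
      trans (Σ<-single N {λ b → [ sieved? σ b d ]⇒ x} b₀<N λ b b<N b≢b₀ →
               []⇒-false (sieved? σ b d) {x} λ (_ , _ , _ , _ , _ , d≡σ[m₁-b]) →
                 b≢b₀ (residue-unique {N} {σ} σ²≡1 {+ d} {m₁} b<N b₀<N d≡σ[m₁-b] d≡σ[m₁-b₀]))
            ([]⇒-cong (sieved? σ b₀ d) (smallDivisor? σ d) {x}
               (λ (gcd≡1 , n≡a , _) → 0<d , d∣n , d²<n , Equivalence.to condition⇔ (gcd≡1 , n≡a))
               (λ (_ , _ , _ , d+q≡σm) → let gcd≡1 , n≡a = Equivalence.from condition⇔ d+q≡σm
                                          in gcd≡1 , n≡a , 0<d , d∣n , d²<n , d≡σ[m₁-b₀]))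
      where
      residue : ∃[ b ] b < N × (+ d) ≡ (σ ℤ.* (m₁ ℤ.- + b)) [mod N ]
      residue = residue-exists N {σ} σ²≡1 (+ d) m₁
      b₀ = proj₁ residue
      b₀<N = proj₁ (proj₂ residue)
      d≡σ[m₁-b₀] = proj₂ (proj₂ residue)
      n≡d*q : n ≡ d * cofactor n d
      n≡d*q = trans n≡q*d (trans (ℕP.*-comm q d) (cong (d *_) (sym (cofactor-* 0<d n≡q*d))))
      condition⇔ = sieve-condition⇔ sieve {n} {d} {cofactor n d} n≡d*q n⊥2N {σ} σ²≡1 m₁ (+ b₀) d≡σ[m₁-b₀]

  root-sum divisor-sum : ℤ → ℚ
  root-sum σ = Σ< (suc n) (λ k → [ root? σ k ]⇒ ((½ ℚ.* 2^ ℓ) ℚ.* ℕ→ℚ (k ^ ℓ)))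
  divisor-sum σ = Σ< (suc n) (λ d → [ smallDivisor? σ d ]⇒ (2^ ℓ ℚ.* ℕ→ℚ (d ^ ℓ)))

  Λσ≡root-sum+divisor-sum : ∀ {σ} → σ ℤ.* σ ≡ + 1 → Λσ ℓ m (2 * N) (4 * n) σ ≡ root-sum σ ℚ.+ divisor-sum σ
  Λσ≡root-sum+divisor-sum {σ} σ²≡1 = trans (Λσ-split σ) (cong₂ ℚ._+_
    (Σ<²-reindex (pair₀-bijection {σ} σ²≡1) (pair₀? σ) (root? σ) (λ t s → ½ ℚ.* u t s)
                 (λ k → (½ ℚ.* 2^ ℓ) ℚ.* ℕ→ℚ (k ^ ℓ)) λ {k} _ _ →
      trans (cong (½ ℚ.*_) (ℕ→ℚ-[d+d]^ℓ k ℓ)) (sym (ℚP.*-assoc ½ (2^ ℓ) (ℕ→ℚ (k ^ ℓ)))))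
    (Σ<²-reindex (pair₊-bijection {σ} σ²≡1) (pair₊? σ) (smallDivisor? σ) u (λ d → 2^ ℓ ℚ.* ℕ→ℚ (d ^ ℓ)) λ {d} _ small →
      trans (cong ℕ→ℚ (cong (_^ ℓ) (smallDivisor-gap {σ} {d} small))) (ℕ→ℚ-[d+d]^ℓ d ℓ)))

  G-term : ℕ → ℚ
  G-term b = [ coprimeZ? (a b) N ]⇒ S (S (G ℓ (m₁ ℤ.- + b) N) K (a b)) 2 (+ 1) n

  G-term≡Σsieved : 2 ∤ n → ∀ b → G-term b ≡ Σ± (λ σ → Σ< (suc n) (λ d → [ sieved? σ b d ]⇒ ℕ→ℚ (d ^ ℓ)))
  G-term≡Σsieved 2∤n b = begin
    G-term b
      ≡⟨ cong ([ coprimeZ? (a b) N ]⇒_) ([]⇒-true ((+ n) ≡? (+ 1) [mod 2 ]) {S (G ℓ (m₁ ℤ.- + b) N) K (a b) n}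
                                                   (Equivalence.from (≡1[mod2]⇔2∤ n) 2∤n)) ⟩
    [ coprimeZ? (a b) N ]⇒ ([ n≡a? ]⇒ G ℓ (m₁ ℤ.- + b) N n)
      ≡⟨ cong ([ coprimeZ? (a b) N ]⇒_) ([]⇒-Σ±Σ< n≡a? (suc n) (gDivisor? b) (λ d → ℕ→ℚ (d ^ ℓ))) ⟩
    [ coprimeZ? (a b) N ]⇒ Σ± (λ σ → Σ< (suc n) (λ d → [ n≡a? ×-dec gDivisor? b σ d ]⇒ ℕ→ℚ (d ^ ℓ)))
      ≡⟨ []⇒-Σ±Σ< (coprimeZ? (a b) N) (suc n) (λ σ d → n≡a? ×-dec gDivisor? b σ d) (λ d → ℕ→ℚ (d ^ ℓ)) ⟩
    Σ± (λ σ → Σ< (suc n) (λ d → [ sieved? σ b d ]⇒ ℕ→ℚ (d ^ ℓ))) ∎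
    where
    n≡a? = (+ n) ≡? a b [mod K ]

  Σ-G-term≡Σ±divisor-sum : .{{_ : NonZero N}} → SieveModulus N K → Coprime n (2 * N) → 2^ ℓ ℚ.* Σ< N G-term ≡ Σ± divisor-sum
  Σ-G-term≡Σ±divisor-sum sieve n⊥2N = begin
    2^ ℓ ℚ.* Σ< N G-term
      ≡⟨ cong (2^ ℓ ℚ.*_) (Σ<-cong N λ b _ → G-term≡Σsieved (coprime-2*⇒2∤ {n} {N} n⊥2N) b) ⟩
    2^ ℓ ℚ.* Σ< N (λ b → Σ± (sieved-sum b))
      ≡⟨ cong (2^ ℓ ℚ.*_) (Σ<-Σ± N sieved-sum) ⟩
    2^ ℓ ℚ.* Σ± (λ σ → Σ< N (λ b → sieved-sum b σ))
      ≡⟨ cong (2^ ℓ ℚ.*_) (Σ±-cong λ σ σ²≡1 →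
           trans (Σ<-comm N (suc n) (λ b d → [ sieved? σ b d ]⇒ ℕ→ℚ (d ^ ℓ)))
                 (Σ<-cong (suc n) λ d _ → Σ-sieved≡smallDivisor sieve n⊥2N {σ} σ²≡1 d (ℕ→ℚ (d ^ ℓ)))) ⟩
    2^ ℓ ℚ.* Σ± (λ σ → Σ< (suc n) (λ d → [ smallDivisor? σ d ]⇒ ℕ→ℚ (d ^ ℓ)))
      ≡⟨ *-Σ±Σ< (2^ ℓ) (suc n) smallDivisor? (λ d → ℕ→ℚ (d ^ ℓ)) ⟩
    Σ± divisor-sum ∎
    where
    sieved-sum : ℕ → ℤ → ℚ
    sieved-sum b σ = Σ< (suc n) (λ d → [ sieved? σ b d ]⇒ ℕ→ℚ (d ^ ℓ))

  lhs rhs : ℚ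
  lhs = χ₀ (2 * N) n ℚ.* Λ ℓ m (2 * N) (4 * n)
  rhs = 2^ ℓ ℚ.* Σ< N G-term ℚ.+ (½ ℚ.* 2^ ℓ) ℚ.* (χ₀ (2 * N) n ℚ.* T ℓ m₁ N n)

  coefficient-coprime : .{{_ : NonZero N}} → SieveModulus N K → NG.gcd n (2 * N) ≡ 1 → lhs ≡ rhs
  coefficient-coprime sieve gcd≡1 = begin
    lhs                                      ≡⟨ χ₀-coprime {2 * N} {n} gcd≡1 (Λ ℓ m (2 * N) (4 * n)) ⟩
    Σ± (Λσ ℓ m (2 * N) (4 * n))              ≡⟨ Σ±-cong (λ σ σ²≡1 → Λσ≡root-sum+divisor-sum {σ} σ²≡1) ⟩
    Σ± (λ σ → root-sum σ ℚ.+ divisor-sum σ)  ≡⟨ Σ±-+ root-sum divisor-sum ⟩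
    Σ± root-sum ℚ.+ Σ± divisor-sum           ≡⟨ ℚP.+-comm (Σ± root-sum) (Σ± divisor-sum) ⟩
    Σ± divisor-sum ℚ.+ Σ± root-sum           ≡⟨ cong₂ ℚ._+_ (Σ-G-term≡Σ±divisor-sum sieve (NC.gcd≡1⇒coprime gcd≡1)) root-part ⟨
    rhs                                      ∎
    where
    root-part : (½ ℚ.* 2^ ℓ) ℚ.* (χ₀ (2 * N) n ℚ.* T ℓ m₁ N n) ≡ Σ± root-sum
    root-part = trans (cong ((½ ℚ.* 2^ ℓ) ℚ.*_) (χ₀-coprime {2 * N} {n} gcd≡1 (T ℓ m₁ N n)))
                   (*-Σ±Σ< (½ ℚ.* 2^ ℓ) (suc n) root? (λ k → ℕ→ℚ (k ^ ℓ)))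

  coefficient-non-coprime : SieveModulus N K → NG.gcd n (2 * N) ≢ 1 → lhs ≡ rhs
  coefficient-non-coprime sieve gcd≢1 = begin
    lhs                                  ≡⟨ χ₀-non-coprime {2 * N} {n} gcd≢1 (Λ ℓ m (2 * N) (4 * n)) ⟩
    0ℚ ℚ.+ 0ℚ                            ≡⟨ cong₂ ℚ._+_ G-part T-part ⟨
    rhs                                  ∎
    where
    G-term-vanishes : ∀ b → G-term b ≡ 0ℚ
    G-term-vanishes b = begin
      G-term b                                            ≡⟨ cong ([ coprimeZ? (a b) N ]⇒_) ([]⇒-[]⇒ n≡1? n≡a? (G ℓ (m₁ ℤ.- + b) N n)) ⟩
      [ coprimeZ? (a b) N ]⇒ ([ n≡1? ×-dec n≡a? ]⇒ G ℓ (m₁ ℤ.- + b) N n)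
                                                          ≡⟨ []⇒-[]⇒ (coprimeZ? (a b) N) (n≡1? ×-dec n≡a?) (G ℓ (m₁ ℤ.- + b) N n) ⟩
      [ coprimeZ? (a b) N ×-dec (n≡1? ×-dec n≡a?) ]⇒ G ℓ (m₁ ℤ.- + b) N n
                                                          ≡⟨ []⇒-false (coprimeZ? (a b) N ×-dec (n≡1? ×-dec n≡a?)) not-sieved ⟩
      0ℚ                                                  ∎
      where
      n≡1? = (+ n) ≡? (+ 1) [mod 2 ]
      n≡a? = (+ n) ≡? a b [mod K ]
      not-sieved : ¬ (ZG.gcd (a b) (+ N) ≡ + 1 × ((+ n) ≡ (+ 1) [mod 2 ]) × ((+ n) ≡ a b [mod K ]))
      not-sieved (gcd≡1 , n≡1 , n≡a) = gcd≢1 (NC.coprime⇒gcd≡1 (coprime-if-sieved sieve {n} (a b) gcd≡1 n≡1 n≡a))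
    G-part : 2^ ℓ ℚ.* Σ< N G-term ≡ 0ℚ
    G-part = trans (cong (2^ ℓ ℚ.*_) (Σ<-zero N λ b _ → G-term-vanishes b)) (ℚP.*-zeroʳ (2^ ℓ))
    T-part : (½ ℚ.* 2^ ℓ) ℚ.* (χ₀ (2 * N) n ℚ.* T ℓ m₁ N n) ≡ 0ℚ
    T-part = trans (cong ((½ ℚ.* 2^ ℓ) ℚ.*_) (χ₀-non-coprime {2 * N} {n} gcd≢1 (T ℓ m₁ N n))) (ℚP.*-zeroʳ (½ ℚ.* 2^ ℓ))

Λ∣U4⊗χ₀-even-coefficient : ∀ ℓ {N K M} .{{_ : NonZero N}} → SieveModulus N K → M ≡ 2 * N → ∀ m₁ n →
            χ₀ M n ℚ.* Λ ℓ (+ 2 ℤ.* m₁) M (4 * n)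
            ≡ 2^ ℓ ℚ.* Σ< N (EvenCoefficient.G-term ℓ N K m₁ n) ℚ.+ (½ ℚ.* 2^ ℓ) ℚ.* (χ₀ M n ℚ.* T ℓ m₁ N n)
Λ∣U4⊗χ₀-even-coefficient ℓ {N} {K} sieve refl m₁ n = by-cases (NG.gcd n (2 * N) ℕ.≟ 1)
  where
  by-cases : Dec (NG.gcd n (2 * N) ≡ 1) → EvenCoefficient.lhs ℓ N K m₁ n ≡ EvenCoefficient.rhs ℓ N K m₁ n
  by-cases (yes gcd≡1) = EvenCoefficient.coefficient-coprime ℓ N K m₁ n sieve gcd≡1
  by-cases (no gcd≢1) = EvenCoefficient.coefficient-non-coprime ℓ N K m₁ n sieve gcd≢1

lemma3p2 : (ℓ e M₁ : ℕ) → e ≥ 1 → M₁ ≥ 1 → ¬ (2 ∣ M₁) →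
    ((m : ℤ) → ¬ ((+ 2) ZDiv.∣ m) →
      ((Λ ℓ m (2 ^ e * M₁) ∣U 4) ⊗ χ₀ (2 ^ e * M₁)) ≈S zeroS)
    ×
    ((m₁ : ℤ) →
      ((Λ ℓ ((+ 2) ℤ.* m₁) (2 ^ e * M₁) ∣U 4) ⊗ χ₀ (2 ^ e * M₁))
      ≈S
      ((2^ ℓ · ΣS (2 ^ (e ∸ 1) * M₁) (λ b₁ →
          λ n → [ coprimeZ? (m₁ ℤ.* m₁ ℤ.- (+ b₁) ℤ.* (+ b₁)) (2 ^ (e ∸ 1) * M₁) ]⇒
            S (S (G ℓ (m₁ ℤ.- (+ b₁)) (2 ^ (e ∸ 1) * M₁)) (2 ^ fOf e * M₁) (m₁ ℤ.* m₁ ℤ.- (+ b₁) ℤ.* (+ b₁))) 2 (+ 1) n))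
       ⊕ ((½ Data.Rational.* 2^ ℓ) · (T ℓ m₁ (2 ^ (e ∸ 1) * M₁) ⊗ χ₀ (2 ^ e * M₁)))))
lemma3p2 ℓ zero M₁ () _ _
lemma3p2 ℓ (suc e) M₁ _ M₁≥1 2∤M₁ =
  (λ m 2∤m → Λ∣U4⊗χ₀-odd≈0 ℓ {2 ^ e * M₁} M≡2N m 2∤m) ,
  (λ m₁ → Λ∣U4⊗χ₀-even-coefficient ℓ {2 ^ e * M₁} {2 ^ fOf (suc e) * M₁} (2^f-sieveModulus e 2∤M₁) M≡2N m₁)
  where
  M≡2N : 2 ^ suc e * M₁ ≡ 2 * (2 ^ e * M₁)
  M≡2N = ℕP.*-assoc 2 (2 ^ e) M₁
  instance
    N≢0 : NonZero (2 ^ e * M₁)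
    N≢0 = ℕP.m*n≢0 (2 ^ e) M₁ {{ℕP.m^n≢0 2 e}} {{ℕ.>-nonZero M₁≥1}}
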